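{- Let $\mathbf{u}$ be a fixed point of a morphism in class $\mathcal{A}_2$. Then the set of factors of $\mathbf{u}$ contains infinitely many antipalindromes.
   Context: Words are over $\{0,1\}$, $\mathbb{N}=\{0,1,2,\dots\}$. $\mathrm{R}(w_1\cdots w_n)=w_n\cdots w_1$; $\mathrm{E}(w_1\cdots w_n)=(1-w_n)\cdots(1-w_1)$; $w$ is an antipalindrome if $\mathrm{E}(w)=w$. $\Theta$ is the Thue–Morse morphism $\Theta(0)=01$, $\Theta(1)=10$. A morphism $\psi:\{0,1\}^*\to\{0,1\}^*$ is in class $\mathcal{A}_2$ if there exist a nonempty word $\mathfrak{w}$ and $k,h\in\mathbb{N}$ with $\psi(0)=\Theta(\mathfrak{w}(\mathrm{R}(\mathfrak{w})\mathfrak{w})^k)$ and $\psi(1)=\Theta((\mathrm{R}(\mathfrak{w})\mathfrak{w})^h\mathrm{R}(\mathfrak{w}))$. A fixed point is an infinite word $\mathbf{u}$ with $\psi(\mathbf{u})=\mathbf{u}$. -}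

module Defs where

open import Data.Bool using (Bool; true; false; not)
open import Data.Nat using (ℕ; zero; suc; _+_)
open import Data.List using (List; []; _∷_; _++_; map; reverse; concatMap; upTo; length)
open import Data.Product using (Σ; _×_; ∃)
open import Relation.Binary.PropositionalEquality using (_≡_; _≢_)

-- Letters: false = 0, true = 1.
Word : Set
Word = List Bool

InfWord : Set
InfWord = ℕ → Bool

R : Word → Word
R = reverse

E : Word → Word
E w = reverse (map not w)

IsAntipalindrome : Word → Set
IsAntipalindrome w = E w ≡ w

Θ : Word → Word
Θ [] = []
Θ (false ∷ w) = false ∷ true ∷ Θ w
Θ (true ∷ w) = true ∷ false ∷ Θ w

pow : ℕ → Word → Word
pow zero v = []
pow (suc k) v = v ++ pow k v

-- A morphism is determined by the images of the letters.
Morphism : Set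
Morphism = Bool → Word

applyM : Morphism → Word → Word
applyM ψ = concatMap ψ

InClassA2 : Morphism → Set
InClassA2 ψ =
  Σ Word λ 𝔴 → 𝔴 ≢ [] × Σ ℕ λ k → Σ ℕ λ h →
    (ψ false ≡ Θ (𝔴 ++ pow k (R 𝔴 ++ 𝔴))) ×
    (ψ true ≡ Θ (pow h (R 𝔴 ++ 𝔴) ++ R 𝔴))

factorAt : InfWord → ℕ → ℕ → Word
factorAt u i n = map (λ j → u (i + j)) (upTo n)

prefix : InfWord → ℕ → Word
prefix u n = factorAt u 0 n

IsFactor : Word → InfWord → Set
IsFactor v u = ∃ λ i → factorAt u i (length v) ≡ v

-- ψ(u) = u: ψ(u) is the infinite word whose prefixes are ψ(u_0⋯u_{n-1});
-- (for non-erasing ψ) ψ(u) = u iff every ψ(prefix) is a prefix of u.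
IsFixedPoint : Morphism → InfWord → Set
IsFixedPoint ψ u = ∀ n → applyM ψ (prefix u n) ≡ prefix u (length (applyM ψ (prefix u n)))

module Submission where

-- Let ψ(0) = Θ(f 0), ψ(1) = Θ(f 1) with f 0 = 𝔴 s^k and f 1 = s^h R(𝔴),
-- where s = R(𝔴)𝔴.  Three facts combine:
--   * E(Θ y) = Θ(R y), so Θ maps palindromes to antipalindromes;
--   * ψ ∘ Θ = Θ ∘ φ for the morphism φ(b) = f b · f (not b), and for 𝒜₂ both
--     φ(0) = 𝔴 s^(k+h) R(𝔴) and φ(1) = s^(h+1+k) are palindromes of length ≥ 2,
--     so φ maps palindromes to palindromes at least twice as long;
--   * a fixed point u of ψ has ψ(p) as a prefix whenever p is a prefix.
-- Starting from the prefix Θ(u₀) of u (its first two letters are u₀, not u₀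
-- because ψ(u₀) is a Θ-image), iterating y ↦ φ(y) gives palindromes y of
-- unbounded length with Θ(y) a prefix of u.  The antipalindromes Θ(y) are
-- then factors of u longer than any word of a given finite list F.

open import Defs
open import Data.Bool using (Bool; true; false; not)
open import Data.Nat using (ℕ; zero; suc; _+_; _*_; _≤_; _<_; z≤n; s≤s)
open import Data.Nat.Properties
  using (≤-trans; ≤-reflexive; +-mono-≤; *-suc; *-zeroʳ; m≤m+n; m≤n⇒m≤1+n; <⇒≱)
open import Data.List using (List; []; _∷_; _++_; [_]; map; reverse; length; concat)
open import Data.List.Properties
  using (++-assoc; ++-identityʳ; map-++; concat-++; reverse-++; unfold-reverse;
         reverse-involutive; length-++; length-reverse; length-++-≤ˡ; length-++-≤ʳ; ∷-injective)
open import Data.List.Extrema.Nat using (max; xs≤max)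
open import Data.List.Relation.Unary.All using (lookup)
open import Data.List.Membership.Propositional using (_∉_)
open import Data.List.Membership.Propositional.Properties using (∈-map⁺)
open import Data.Product using (Σ; ∃; _×_; _,_; proj₁; proj₂)
open import Data.Empty using (⊥-elim)
open import Relation.Binary.PropositionalEquality
  using (_≡_; _≢_; refl; sym; trans; cong; cong₂; subst; module ≡-Reasoning)

open ≡-Reasoning

IsPalindrome : Word → Set
IsPalindrome w = R w ≡ w

E-++ : ∀ x y → E (x ++ y) ≡ E y ++ E x
E-++ x y = trans (cong reverse (map-++ not x y)) (reverse-++ (map not x) (map not y))

Θ-++ : ∀ x y → Θ (x ++ y) ≡ Θ x ++ Θ y
Θ-++ [] y = refl
Θ-++ (false ∷ x) y = cong (λ z → false ∷ true ∷ z) (Θ-++ x y)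
Θ-++ (true ∷ x) y = cong (λ z → true ∷ false ∷ z) (Θ-++ x y)

Θ-∷ : ∀ c z → Θ (c ∷ z) ≡ c ∷ not c ∷ Θ z
Θ-∷ false z = refl
Θ-∷ true z = refl

length-Θ : ∀ y → length y ≤ length (Θ y)
length-Θ [] = z≤n
length-Θ (false ∷ y) = s≤s (m≤n⇒m≤1+n (length-Θ y))
length-Θ (true ∷ y) = s≤s (m≤n⇒m≤1+n (length-Θ y))

E-Θ : ∀ y → E (Θ y) ≡ Θ (R y)
E-Θ [] = refl
E-Θ (b ∷ y) = begin
  E (Θ (b ∷ y))         ≡⟨ cong E (Θ-++ [ b ] y) ⟩
  E (Θ [ b ] ++ Θ y)    ≡⟨ E-++ (Θ [ b ]) (Θ y) ⟩
  E (Θ y) ++ E (Θ [ b ]) ≡⟨ cong₂ _++_ (E-Θ y) (letter b) ⟩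
  Θ (R y) ++ Θ [ b ]    ≡⟨ sym (Θ-++ (R y) [ b ]) ⟩
  Θ (R y ++ [ b ])      ≡⟨ cong Θ (sym (unfold-reverse b y)) ⟩
  Θ (R (b ∷ y))         ∎
  where
  letter : ∀ b → E (Θ [ b ]) ≡ Θ [ b ]
  letter false = refl
  letter true = refl

Θ-palindrome⇒antipalindrome : ∀ {y} → IsPalindrome y → IsAntipalindrome (Θ y)
Θ-palindrome⇒antipalindrome {y} pal = trans (E-Θ y) (cong Θ pal)

applyM-++ : ∀ g x y → applyM g (x ++ y) ≡ applyM g x ++ applyM g y
applyM-++ g x y = trans (cong concat (map-++ g x y)) (sym (concat-++ (map g x) (map g y)))

applyM-reverse : ∀ g → (∀ b → IsPalindrome (g b)) → ∀ y → R (applyM g y) ≡ applyM g (R y)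
applyM-reverse g pal [] = refl
applyM-reverse g pal (a ∷ y) = begin
  R (g a ++ applyM g y)             ≡⟨ reverse-++ (g a) (applyM g y) ⟩
  R (applyM g y) ++ R (g a)         ≡⟨ cong₂ _++_ (applyM-reverse g pal y) (pal a) ⟩
  applyM g (R y) ++ g a             ≡⟨ cong (applyM g (R y) ++_) (sym (++-identityʳ (g a))) ⟩
  applyM g (R y) ++ applyM g [ a ]  ≡⟨ sym (applyM-++ g (R y) [ a ]) ⟩
  applyM g (R y ++ [ a ])           ≡⟨ cong (applyM g) (sym (unfold-reverse a y)) ⟩
  applyM g (R (a ∷ y))              ∎

applyM-length : ∀ g m → (∀ b → m ≤ length (g b)) → ∀ y → m * length y ≤ length (applyM g y)
applyM-length g m long [] = ≤-reflexive (*-zeroʳ m)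
applyM-length g m long (a ∷ y) =
  -- m·(1+|y|) = m + m·|y| ≤ |g a| + |applyM g y| = |g a · applyM g y|
  ≤-trans (≤-reflexive (*-suc m (length y)))
    (≤-trans (+-mono-≤ (long a) (applyM-length g m long y)) (≤-reflexive (sym (length-++ (g a)))))

conjugate : (Bool → Word) → Morphism
conjugate f b = f b ++ f (not b)

Θ-conjugate : ∀ ψ f → (∀ b → ψ b ≡ Θ (f b)) → ∀ y → applyM ψ (Θ y) ≡ Θ (applyM (conjugate f) y)
Θ-conjugate ψ f image [] = refl
Θ-conjugate ψ f image (b ∷ y) = begin
  applyM ψ (Θ (b ∷ y))                                ≡⟨ cong (applyM ψ) (Θ-∷ b y) ⟩
  ψ b ++ (ψ (not b) ++ applyM ψ (Θ y))                ≡⟨ cong₂ _++_ (image b)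
                                                          (cong₂ _++_ (image (not b)) (Θ-conjugate ψ f image y)) ⟩
  Θ (f b) ++ (Θ (f (not b)) ++ Θ (applyM φ y))        ≡⟨ cong (Θ (f b) ++_) (sym (Θ-++ (f (not b)) _)) ⟩
  Θ (f b) ++ Θ (f (not b) ++ applyM φ y)              ≡⟨ sym (Θ-++ (f b) _) ⟩
  Θ (f b ++ (f (not b) ++ applyM φ y))                ≡⟨ cong Θ (sym (++-assoc (f b) (f (not b)) _)) ⟩
  Θ (applyM φ (b ∷ y))                                ∎
  where
  φ : Morphism
  φ = conjugate f

conjugate-length : ∀ f → (∀ b → 1 ≤ length (f b)) → ∀ b → 2 ≤ length (conjugate f b)
conjugate-length f nonempty b =
  subst (2 ≤_) (sym (length-++ (f b))) (+-mono-≤ (nonempty b) (nonempty (not b)))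

pow-+ : ∀ a b s → pow (a + b) s ≡ pow a s ++ pow b s
pow-+ zero b s = refl
pow-+ (suc a) b s = trans (cong (s ++_) (pow-+ a b s)) (sym (++-assoc s (pow a s) (pow b s)))

pow-snoc : ∀ n s → pow n s ++ s ≡ s ++ pow n s
pow-snoc zero s = sym (++-identityʳ s)
pow-snoc (suc n) s = trans (++-assoc s (pow n s) s) (cong (s ++_) (pow-snoc n s))

palindrome-pow : ∀ {s} n → IsPalindrome s → IsPalindrome (pow n s)
palindrome-pow zero pal = refl
palindrome-pow {s} (suc n) pal = begin
  R (s ++ pow n s)       ≡⟨ reverse-++ s (pow n s) ⟩
  R (pow n s) ++ R s     ≡⟨ cong₂ _++_ (palindrome-pow n pal) pal ⟩
  pow n s ++ s           ≡⟨ pow-snoc n s ⟩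
  s ++ pow n s           ∎

palindrome-wrap : ∀ x {s} → IsPalindrome s → IsPalindrome (x ++ s ++ R x)
palindrome-wrap x {s} pal = begin
  R (x ++ s ++ R x)       ≡⟨ reverse-++ x (s ++ R x) ⟩
  R (s ++ R x) ++ R x     ≡⟨ cong (_++ R x) (reverse-++ s (R x)) ⟩
  (R (R x) ++ R s) ++ R x ≡⟨ cong₂ (λ a b → (a ++ b) ++ R x) (reverse-involutive x) pal ⟩
  (x ++ s) ++ R x         ≡⟨ ++-assoc x s (R x) ⟩
  x ++ s ++ R x           ∎

nonempty-length : ∀ {w : Word} → w ≢ [] → 1 ≤ length w
nonempty-length {[]} w≢[] = ⊥-elim (w≢[] refl)
nonempty-length {_ ∷ _} _ = s≤s z≤n

module A2Images (𝔴 : Word) (k h : ℕ) where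

  s : Word
  s = R 𝔴 ++ 𝔴

  image : Bool → Word
  image false = 𝔴 ++ pow k s
  image true = pow h s ++ R 𝔴

  s-palindrome : IsPalindrome s
  s-palindrome = trans (reverse-++ (R 𝔴) 𝔴) (cong (R 𝔴 ++_) (reverse-involutive 𝔴))

  conjugate-palindrome : ∀ b → IsPalindrome (conjugate image b)
  conjugate-palindrome false =
    subst IsPalindrome (sym shape) (palindrome-wrap 𝔴 (palindrome-pow (k + h) s-palindrome))
    where
    shape : (𝔴 ++ pow k s) ++ (pow h s ++ R 𝔴) ≡ 𝔴 ++ pow (k + h) s ++ R 𝔴
    shape = begin
      (𝔴 ++ pow k s) ++ (pow h s ++ R 𝔴)   ≡⟨ ++-assoc 𝔴 (pow k s) _ ⟩
      𝔴 ++ (pow k s ++ (pow h s ++ R 𝔴))   ≡⟨ cong (𝔴 ++_) (sym (++-assoc (pow k s) (pow h s) (R 𝔴))) ⟩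
      𝔴 ++ (pow k s ++ pow h s) ++ R 𝔴     ≡⟨ cong (λ z → 𝔴 ++ z ++ R 𝔴) (sym (pow-+ k h s)) ⟩
      𝔴 ++ pow (k + h) s ++ R 𝔴            ∎
  conjugate-palindrome true =
    subst IsPalindrome (sym shape) (palindrome-pow (h + suc k) s-palindrome)
    where
    shape : (pow h s ++ R 𝔴) ++ (𝔴 ++ pow k s) ≡ pow (h + suc k) s
    shape = begin
      (pow h s ++ R 𝔴) ++ (𝔴 ++ pow k s)   ≡⟨ ++-assoc (pow h s) (R 𝔴) _ ⟩
      pow h s ++ (R 𝔴 ++ (𝔴 ++ pow k s))   ≡⟨ cong (pow h s ++_) (sym (++-assoc (R 𝔴) 𝔴 (pow k s))) ⟩
      pow h s ++ pow (suc k) s             ≡⟨ sym (pow-+ h (suc k) s) ⟩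
      pow (h + suc k) s                    ∎

  image-nonempty : 𝔴 ≢ [] → ∀ b → 1 ≤ length (image b)
  image-nonempty 𝔴≢[] false = ≤-trans (nonempty-length 𝔴≢[]) (length-++-≤ˡ 𝔴)
  image-nonempty 𝔴≢[] true =
    ≤-trans (subst (1 ≤_) (sym (length-reverse 𝔴)) (nonempty-length 𝔴≢[])) (length-++-≤ʳ (R 𝔴) {pow h s})

IsPrefix : Word → InfWord → Set
IsPrefix w u = w ≡ prefix u (length w)

fixedPoint-prefix : ∀ {ψ u} → IsFixedPoint ψ u → ∀ w → IsPrefix w u → IsPrefix (applyM ψ w) u
fixedPoint-prefix {ψ} {u} fp w pre = subst (λ x → IsPrefix (applyM ψ x) u) (sym pre) (fp (length w))

Θ-prefix-alternates : ∀ {u} z rest → 1 ≤ length z → IsPrefix (Θ z ++ rest) u → u 1 ≡ not (u 0)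
Θ-prefix-alternates {u} (c ∷ z) rest _ pre = trans (sym second) (cong not first)
  where
  pre′ : c ∷ not c ∷ (Θ z ++ rest) ≡ prefix u (suc (suc (length (Θ z ++ rest))))
  pre′ = subst (λ x → IsPrefix (x ++ rest) u) (Θ-∷ c z) pre
  first : c ≡ u 0
  first = proj₁ (∷-injective pre′)
  second : not c ≡ u 1
  second = proj₁ (∷-injective (proj₂ (∷-injective pre′)))

maxLength : List Word → ℕ
maxLength F = max 0 (map length F)

longer-∉ : ∀ F {v} → maxLength F < length v → v ∉ F
longer-∉ F long v∈F = <⇒≱ long (lookup (xs≤max 0 (map length F)) (∈-map⁺ length v∈F))

module A2FixedPoint (ψ : Morphism) (𝔴 : Word) (𝔴≢[] : 𝔴 ≢ []) (k h : ℕ)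
  (ψ0 : ψ false ≡ Θ (𝔴 ++ pow k (R 𝔴 ++ 𝔴)))
  (ψ1 : ψ true ≡ Θ (pow h (R 𝔴 ++ 𝔴) ++ R 𝔴))
  (u : InfWord) (fp : IsFixedPoint ψ u) where

  open A2Images 𝔴 k h

  ψ-image : ∀ b → ψ b ≡ Θ (image b)
  ψ-image false = ψ0
  ψ-image true = ψ1

  -- ψ(u₀) is a prefix of u and a Θ-image, so Θ(u₀) = u₀ u₁ is a prefix.
  seed : IsPrefix (Θ [ u 0 ]) u
  seed = subst (λ x → IsPrefix x u) (sym (Θ-∷ (u 0) [])) (cong (λ d → u 0 ∷ d ∷ []) (sym alternates))
    where
    alternates : u 1 ≡ not (u 0)
    alternates = Θ-prefix-alternates (image (u 0)) [] (image-nonempty 𝔴≢[] (u 0))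
      (subst (λ x → IsPrefix (x ++ []) u) (ψ-image (u 0)) (fixedPoint-prefix fp [ u 0 ] refl))

  -- φ at least doubles lengths, so the invariant n < |y| advances to n+1 < |φ(y)|.
  doubling : ∀ {n} y → n < length y → suc n < length (applyM (conjugate image) y)
  doubling y n<y = ≤-trans (+-mono-≤ (≤-trans (s≤s z≤n) n<y) (≤-trans n<y (m≤m+n _ 0)))
                           (applyM-length (conjugate image) 2 (conjugate-length image (image-nonempty 𝔴≢[])) y)

  long-palindromic-prefix : ∀ n → Σ Word λ y → IsPalindrome y × n < length y × IsPrefix (Θ y) u
  long-palindromic-prefix zero = [ u 0 ] , refl , s≤s z≤n , seed
  long-palindromic-prefix (suc n) with long-palindromic-prefix n
  ... | y , pal , n<y , pre = applyM φ y , pal′ , doubling y n<y , pre′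
    where
    φ : Morphism
    φ = conjugate image
    pal′ : IsPalindrome (applyM φ y)
    pal′ = trans (applyM-reverse φ conjugate-palindrome y) (cong (applyM φ) pal)
    pre′ : IsPrefix (Θ (applyM φ y)) u
    pre′ = subst (λ x → IsPrefix x u) (Θ-conjugate ψ image ψ-image y) (fixedPoint-prefix fp (Θ y) pre)

proposition17 : (ψ : Morphism) → InClassA2 ψ → (u : InfWord) → IsFixedPoint ψ u →
    (F : List Word) → ∃ λ v → IsFactor v u × IsAntipalindrome v × v ∉ F
proposition17 ψ (𝔴 , 𝔴≢[] , k , h , ψ0 , ψ1) u fp F
  with A2FixedPoint.long-palindromic-prefix ψ 𝔴 𝔴≢[] k h ψ0 ψ1 u fp (maxLength F)
... | y , pal , long , pre =
  Θ y , (0 , sym pre) , Θ-palindrome⇒antipalindrome pal , longer-∉ F (≤-trans long (length-Θ y))
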